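{- Let $W_2$ be the graph defined below, with distinguished vertices $u,v$. If $S$ is an assignment of sets $S(z)\subseteq\mathbb{Z}$ with $|S(z)|=3$ for all vertices $z$ of $W_2$, then $|incomp(W_2,u,v,S)|\le 1$.
   Context: $W_2$ is the graph on the $21$ vertices $u,v,w,x_1,x_2,x_3,x_4,p_1,\dots,p_5,y_1,y_2,y_3,y_4,q_1,\dots,q_5$ with the following edges: the $5$-cycles $w x_1 x_2 x_3 x_4 w$, $p_1p_2p_3p_4p_5p_1$, $w y_1 y_2 y_3 y_4 w$, $q_1q_2q_3q_4q_5q_1$; the edges $wp_1, x_1p_2, x_2p_3, x_3p_4, x_4p_5$ and $wq_1, y_1q_2, y_2q_3, y_3q_4, y_4q_5$; the edges $uw, ux_2, uy_2$; and the edges $vx_2, vx_4, vy_2, vy_4$. (It is planar and triangle-free.) For a graph $G=(V,E)$, two distinct vertices $u,v$ of $G$ and an assignment $S$ of sets $S(z)\subseteq\mathbb{Z}$ to all $z\in V$, $incomp(G,u,v,S)$ denotes the set of pairs $(a,b)\in S(u)\times S(v)$ such that there is no proper vertex coloring $c:V\to\mathbb{Z}$ with $c(u)=a$, $c(v)=b$ and $c(z)\in S(z)$ for all $z\in V$. -}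

module Defs where

open import Data.Integer using (ℤ)
open import Data.Product using (_×_; _,_; Σ; ∃)
open import Data.Vec using (Vec)
open import Data.Vec.Membership.Propositional using (_∈_)
open import Data.Fin using (Fin)
open import Function.Definitions using (Injective)
open import Relation.Binary.PropositionalEquality using (_≡_; _≢_)
open import Relation.Nullary using (¬_)

data V : Set where
  u v w x₁ x₂ x₃ x₄ p₁ p₂ p₃ p₄ p₅ y₁ y₂ y₃ y₄ q₁ q₂ q₃ q₄ q₅ : V

-- The edge list of W₂ (each undirected edge listed once).
data Edge : V → V → Set where
  e-wx₁ : Edge w x₁
  e-x₁x₂ : Edge x₁ x₂
  e-x₂x₃ : Edge x₂ x₃
  e-x₃x₄ : Edge x₃ x₄
  e-x₄w : Edge x₄ w
  e-p₁p₂ : Edge p₁ p₂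
  e-p₂p₃ : Edge p₂ p₃
  e-p₃p₄ : Edge p₃ p₄
  e-p₄p₅ : Edge p₄ p₅
  e-p₅p₁ : Edge p₅ p₁
  e-wy₁ : Edge w y₁
  e-y₁y₂ : Edge y₁ y₂
  e-y₂y₃ : Edge y₂ y₃
  e-y₃y₄ : Edge y₃ y₄
  e-y₄w : Edge y₄ w
  e-q₁q₂ : Edge q₁ q₂
  e-q₂q₃ : Edge q₂ q₃
  e-q₃q₄ : Edge q₃ q₄
  e-q₄q₅ : Edge q₄ q₅
  e-q₅q₁ : Edge q₅ q₁
  e-wp₁ : Edge w p₁
  e-x₁p₂ : Edge x₁ p₂
  e-x₂p₃ : Edge x₂ p₃
  e-x₃p₄ : Edge x₃ p₄
  e-x₄p₅ : Edge x₄ p₅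
  e-wq₁ : Edge w q₁
  e-y₁q₂ : Edge y₁ q₂
  e-y₂q₃ : Edge y₂ q₃
  e-y₃q₄ : Edge y₃ q₄
  e-y₄q₅ : Edge y₄ q₅
  e-uw : Edge u w
  e-ux₂ : Edge u x₂
  e-uy₂ : Edge u y₂
  e-vx₂ : Edge v x₂
  e-vx₄ : Edge v x₄
  e-vy₂ : Edge v y₂
  e-vy₄ : Edge v y₄

-- A list assignment of 3-element sets of integers: S z is given by an
-- injective enumeration Fin 3 → ℤ, i.e. a set of exactly 3 integers.
record Assignment3 : Set where
  field
    S      : V → Vec ℤ 3
    S-size : ∀ z → Injective _≡_ _≡_ (Data.Vec.lookup (S z))

Proper : (V → ℤ) → Set
Proper c = ∀ {a b} → Edge a b → c a ≢ c b

FromLists : (V → Vec ℤ 3) → (V → ℤ) → Set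
FromLists S c = ∀ z → c z ∈ S z

Incomp : (V → Vec ℤ 3) → ℤ × ℤ → Set
Incomp S (a , b) =
  (a ∈ S u) × (b ∈ S v) ×
  ¬ (Σ (V → ℤ) λ c → Proper c × FromLists S c × c u ≡ a × c v ≡ b)

AtMostOne : (ℤ × ℤ → Set) → Set
AtMostOne P = ∀ {x y} → P x → P y → x ≡ y

-- A colouring of u, v, w extends to W₂ unless one of its two wings (x₁ … x₄ with the pentagon
-- p₁ … p₅, and y₁ … y₄ with q₁ … q₅) fails to extend.  Colouring a wing greedily, it fails only if
-- its pentagon is blocked: after removing the colour of each vertex's outside neighbour, all five
-- vertices are left with one and the same pair of colours.  The outside colours of a blocked
-- pentagon are determined by its lists, so each wing is blocked at one colour of w at most.  As w
-- has three colours, two incompatible pairs (a, b), (a′, b′) must have a = a′, and the x-wing is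
-- blocked for both; in both cases x₂ is then forced to the same colour t₂, and since x₂ has two
-- colours other than a, b = b′.

module Submission where

open import Data.Empty using (⊥-elim)
open import Data.Fin using (zero; suc)
open import Data.Fin.Properties using (0≢1+n; suc-injective)
open import Data.Integer using (ℤ)
open import Data.Integer.Properties using (_≟_)
open import Data.Product using (_×_; _,_; ∃; ∃₂; proj₁; proj₂)
open import Data.Sum using (_⊎_; inj₁; inj₂)
import Data.Sum as Sum
open import Data.Vec using (Vec; _∷_; []; lookup)
open import Data.Vec.Relation.Unary.Any using (here; there)
open import Data.Vec.Membership.Propositional using (_∈_)
open import Function.Definitions using (Injective)
open import Level using (0ℓ)
open import Relation.Binary.Definitions using (DecidableEquality)
open import Relation.Binary.PropositionalEquality using (_≡_; _≢_; refl; sym; trans; cong; subst; ≢-sym)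
open import Relation.Nullary using (¬_; yes; no; Dec)
open import Relation.Nullary.Decidable using (decidable-stable; _×-dec_; _⊎-dec_; ¬?)
open import Relation.Unary using (Pred; Decidable; _⊆_; _∪_; ∅)

open import Defs

module ListColouring {C : Set} (_≟_ : DecidableEquality C) where

  record Triple : Set where
    constructor triple
    field
      l₀ l₁ l₂ : C
      l₀≢l₁ : l₀ ≢ l₁
      l₀≢l₂ : l₀ ≢ l₂
      l₁≢l₂ : l₁ ≢ l₂
  open Triple public

  infix 4 _∈₃_
  _∈₃_ : C → Triple → Set
  z ∈₃ t = z ≡ l₀ t ⊎ z ≡ l₁ t ⊎ z ≡ l₂ t

  _∈₃?_ : ∀ z t → Dec (z ∈₃ t)
  z ∈₃? t = z ≟ l₀ t ⊎-dec z ≟ l₁ t ⊎-dec z ≟ l₂ t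

  fromVec : (xs : Vec C 3) → Injective _≡_ _≡_ (lookup xs) → Triple
  fromVec (x ∷ y ∷ z ∷ []) distinct = triple x y z
    (λ x≡y → 0≢1+n (distinct {zero} {suc zero} x≡y))
    (λ x≡z → 0≢1+n (distinct {zero} {suc (suc zero)} x≡z))
    (λ y≡z → 0≢1+n (suc-injective (distinct {suc zero} {suc (suc zero)} y≡z)))

  ∈-fromVec : ∀ xs (distinct : Injective _≡_ _≡_ (lookup xs)) {z} → z ∈₃ fromVec xs distinct → z ∈ xs
  ∈-fromVec (_ ∷ _ ∷ _ ∷ []) _ (inj₁ z≡x) = here z≡x
  ∈-fromVec (_ ∷ _ ∷ _ ∷ []) _ (inj₂ (inj₁ z≡y)) = there (here z≡y)
  ∈-fromVec (_ ∷ _ ∷ _ ∷ []) _ (inj₂ (inj₂ z≡z′)) = there (there (here z≡z′))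

  any₃? : ∀ {P : Pred C 0ℓ} → Decidable P → ∀ t → Dec (∃ λ z → z ∈₃ t × P z)
  any₃? P? t with P? (l₀ t) | P? (l₁ t) | P? (l₂ t)
  ... | yes p | _ | _ = yes (_ , inj₁ refl , p)
  ... | no _ | yes p | _ = yes (_ , inj₂ (inj₁ refl) , p)
  ... | no _ | no _ | yes p = yes (_ , inj₂ (inj₂ refl) , p)
  ... | no ¬p₀ | no ¬p₁ | no ¬p₂ = no λ where
    (_ , inj₁ refl , p) → ¬p₀ p
    (_ , inj₂ (inj₁ refl) , p) → ¬p₁ p
    (_ , inj₂ (inj₂ refl) , p) → ¬p₂ p

  Subsingleton : Pred C 0ℓ → Set
  Subsingleton P = ∀ {z z′} → P z → P z′ → z ≡ z′

  ≡-subsingleton : ∀ c → Subsingleton (_≡ c)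
  ≡-subsingleton c z≡c z′≡c = trans z≡c (sym z′≡c)

  pigeonhole₃ : ∀ {P Q R : Pred C 0ℓ} t → Subsingleton Q → Subsingleton R →
                (_∈₃ t) ⊆ P ∪ Q ∪ R → ∃ λ z → z ∈₃ t × P z
  pigeonhole₃ t Q! R! cover
    with cover (inj₁ refl) | cover (inj₂ (inj₁ refl)) | cover (inj₂ (inj₂ refl))
  ... | inj₁ p | _ | _ = _ , inj₁ refl , p
  ... | _ | inj₁ p | _ = _ , inj₂ (inj₁ refl) , p
  ... | _ | _ | inj₁ p = _ , inj₂ (inj₂ refl) , p
  ... | inj₂ (inj₁ q) | inj₂ (inj₁ q′) | _ = ⊥-elim (l₀≢l₁ t (Q! q q′))
  ... | inj₂ (inj₂ r) | inj₂ (inj₂ r′) | _ = ⊥-elim (l₀≢l₁ t (R! r r′))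
  ... | inj₂ (inj₁ q) | _ | inj₂ (inj₁ q′) = ⊥-elim (l₀≢l₂ t (Q! q q′))
  ... | inj₂ (inj₂ r) | _ | inj₂ (inj₂ r′) = ⊥-elim (l₀≢l₂ t (R! r r′))
  ... | _ | inj₂ (inj₁ q) | inj₂ (inj₁ q′) = ⊥-elim (l₁≢l₂ t (Q! q q′))
  ... | _ | inj₂ (inj₂ r) | inj₂ (inj₂ r′) = ⊥-elim (l₁≢l₂ t (R! r r′))

  ¬-⊆-subsingletons : ∀ {Q R : Pred C 0ℓ} t → Subsingleton Q → Subsingleton R → ¬ ((_∈₃ t) ⊆ Q ∪ R)
  ¬-⊆-subsingletons t Q! R! cover = proj₂ (proj₂ (pigeonhole₃ {P = ∅} t Q! R! (λ z∈ → inj₂ (cover z∈))))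

  avoid₂ : ∀ t c d → ∃ λ z → z ∈₃ t × z ≢ c × z ≢ d
  avoid₂ t c d = pigeonhole₃ t (≡-subsingleton c) (≡-subsingleton d) avoids
    where
      avoids : (_∈₃ t) ⊆ (λ z → z ≢ c × z ≢ d) ∪ (_≡ c) ∪ (_≡ d)
      avoids {z} _ with z ≟ c | z ≟ d
      ... | yes z≡c | _ = inj₂ (inj₁ z≡c)
      ... | _ | yes z≡d = inj₂ (inj₂ z≡d)
      ... | no z≢c | no z≢d = inj₁ (z≢c , z≢d)

  infix 6 _∖_
  _∖_ : Triple → C → Pred C 0ℓ
  (t ∖ c) z = z ∈₃ t × z ≢ c

  ∖? : ∀ t c → Decidable (t ∖ c)
  ∖? t c z = z ∈₃? t ×-dec ¬? (z ≟ c)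

  ⊆-or-escape : ∀ t c t′ c′ → t ∖ c ⊆ t′ ∖ c′ ⊎ ∃ λ γ → (t ∖ c) γ × ¬ (t′ ∖ c′) γ
  ⊆-or-escape t c t′ c′ with any₃? (λ γ → ¬? (γ ≟ c) ×-dec ¬? (∖? t′ c′ γ)) t
  ... | yes (γ , γ∈t , γ≢c , γ∉) = inj₂ (γ , (γ∈t , γ≢c) , γ∉)
  ... | no ¬escape = inj₁ λ {γ} (γ∈t , γ≢c) →
    decidable-stable (∖? t′ c′ γ) (λ γ∉ → ¬escape (γ , γ∈t , γ≢c , γ∉))

  record Pentagon : Set where
    constructor pentagon
    field
      L₁ L₂ L₃ L₄ L₅ : Triple
  open Pentagon public

  rotate : Pentagon → Pentagon
  rotate P = pentagon (L₂ P) (L₃ P) (L₄ P) (L₅ P) (L₁ P)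

  -- Vertex i of the pentagon has a neighbour outside it coloured cᵢ.
  record PentagonColouring (P : Pentagon) (c₁ c₂ c₃ c₄ c₅ : C) : Set where
    constructor pentagon-colouring
    field
      z₁ z₂ z₃ z₄ z₅ : C
      z₁∈ : (L₁ P ∖ c₁) z₁
      z₂∈ : (L₂ P ∖ c₂) z₂
      z₃∈ : (L₃ P ∖ c₃) z₃
      z₄∈ : (L₄ P ∖ c₄) z₄
      z₅∈ : (L₅ P ∖ c₅) z₅
      z₁≢z₂ : z₁ ≢ z₂
      z₂≢z₃ : z₂ ≢ z₃
      z₃≢z₄ : z₃ ≢ z₄
      z₄≢z₅ : z₄ ≢ z₅
      z₅≢z₁ : z₅ ≢ z₁

  unrotate : ∀ {P c₁ c₂ c₃ c₄ c₅} →
             PentagonColouring (rotate P) c₂ c₃ c₄ c₅ c₁ → PentagonColouring P c₁ c₂ c₃ c₄ c₅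
  unrotate (pentagon-colouring z₂ z₃ z₄ z₅ z₁ z₂∈ z₃∈ z₄∈ z₅∈ z₁∈ z₂≢z₃ z₃≢z₄ z₄≢z₅ z₅≢z₁ z₁≢z₂) =
    pentagon-colouring z₁ z₂ z₃ z₄ z₅ z₁∈ z₂∈ z₃∈ z₄∈ z₅∈ z₁≢z₂ z₂≢z₃ z₃≢z₄ z₄≢z₅ z₅≢z₁

  -- The cyclic inclusions make all the sets Lᵢ ∖ cᵢ equal, and c₁ ∈ L₁ makes this common set
  -- a pair: the pentagon, an odd cycle, cannot be coloured from it.
  record Blocked (P : Pentagon) (c₁ c₂ c₃ c₄ c₅ : C) : Set where
    field
      incl₁₂ : L₁ P ∖ c₁ ⊆ L₂ P ∖ c₂
      incl₂₃ : L₂ P ∖ c₂ ⊆ L₃ P ∖ c₃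
      incl₃₄ : L₃ P ∖ c₃ ⊆ L₄ P ∖ c₄
      incl₄₅ : L₄ P ∖ c₄ ⊆ L₅ P ∖ c₅
      incl₅₁ : L₅ P ∖ c₅ ⊆ L₁ P ∖ c₁
      c₁∈L₁ : c₁ ∈₃ L₁ P
      c₃∈L₃ : c₃ ∈₃ L₃ P

  colour-from-escape : ∀ {P c₁ c₂ c₃ c₄ c₅ γ} → (L₁ P ∖ c₁) γ → ¬ (L₂ P ∖ c₂) γ →
                       PentagonColouring P c₁ c₂ c₃ c₄ c₅
  colour-from-escape {P} {c₁} {c₂} {c₃} {c₄} {c₅} {γ} γ∈ γ∉ =
    let (z₅ , z₅∈ , z₅≢c₅ , z₅≢γ) = avoid₂ (L₅ P) c₅ γ
        (z₄ , z₄∈ , z₄≢c₄ , z₄≢z₅) = avoid₂ (L₄ P) c₄ z₅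
        (z₃ , z₃∈ , z₃≢c₃ , z₃≢z₄) = avoid₂ (L₃ P) c₃ z₄
        (z₂ , z₂∈ , z₂≢c₂ , z₂≢z₃) = avoid₂ (L₂ P) c₂ z₃
    in pentagon-colouring γ z₂ z₃ z₄ z₅ γ∈ (z₂∈ , z₂≢c₂) (z₃∈ , z₃≢c₃) (z₄∈ , z₄≢c₄) (z₅∈ , z₅≢c₅)
         (λ γ≡z₂ → γ∉ (subst (L₂ P ∖ c₂) (sym γ≡z₂) (z₂∈ , z₂≢c₂))) z₂≢z₃ z₃≢z₄ z₄≢z₅ z₅≢γ

  colour-from-spare : ∀ {P c₁ c₂ c₃ c₄ c₅} →
                      L₁ P ∖ c₁ ⊆ L₂ P ∖ c₂ → L₂ P ∖ c₂ ⊆ L₃ P ∖ c₃ →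
                      L₃ P ∖ c₃ ⊆ L₄ P ∖ c₄ → L₄ P ∖ c₄ ⊆ L₅ P ∖ c₅ →
                      ¬ c₁ ∈₃ L₁ P → PentagonColouring P c₁ c₂ c₃ c₄ c₅
  colour-from-spare {P} {c₁} i₁₂ i₂₃ i₃₄ i₄₅ c₁∉ =
    pentagon-colouring (l₀ t) (l₁ t) (l₀ t) (l₁ t) (l₂ t)
      (spare m₀) (i₁₂ (spare m₁)) (i₂₃ (i₁₂ (spare m₀)))
      (i₃₄ (i₂₃ (i₁₂ (spare m₁)))) (i₄₅ (i₃₄ (i₂₃ (i₁₂ (spare m₂)))))
      (l₀≢l₁ t) (≢-sym (l₀≢l₁ t)) (l₀≢l₁ t) (l₁≢l₂ t) (≢-sym (l₀≢l₂ t))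
    where
      t = L₁ P
      m₀ : l₀ t ∈₃ t
      m₀ = inj₁ refl
      m₁ : l₁ t ∈₃ t
      m₁ = inj₂ (inj₁ refl)
      m₂ : l₂ t ∈₃ t
      m₂ = inj₂ (inj₂ refl)
      spare : ∀ {z} → z ∈₃ t → (t ∖ c₁) z
      spare z∈ = z∈ , λ { refl → c₁∉ z∈ }

  colour-or-block : ∀ P c₁ c₂ c₃ c₄ c₅ → PentagonColouring P c₁ c₂ c₃ c₄ c₅ ⊎ Blocked P c₁ c₂ c₃ c₄ c₅
  colour-or-block P c₁ c₂ c₃ c₄ c₅
    with ⊆-or-escape (L₁ P) c₁ (L₂ P) c₂ | ⊆-or-escape (L₂ P) c₂ (L₃ P) c₃
       | ⊆-or-escape (L₃ P) c₃ (L₄ P) c₄ | ⊆-or-escape (L₄ P) c₄ (L₅ P) c₅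
       | ⊆-or-escape (L₅ P) c₅ (L₁ P) c₁
  ... | inj₂ (_ , γ∈ , γ∉) | _ | _ | _ | _ = inj₁ (colour-from-escape γ∈ γ∉)
  ... | _ | inj₂ (_ , γ∈ , γ∉) | _ | _ | _ = inj₁ (unrotate (colour-from-escape γ∈ γ∉))
  ... | _ | _ | inj₂ (_ , γ∈ , γ∉) | _ | _ = inj₁ (unrotate (unrotate (colour-from-escape γ∈ γ∉)))
  ... | _ | _ | _ | inj₂ (_ , γ∈ , γ∉) | _ =
    inj₁ (unrotate (unrotate (unrotate (colour-from-escape γ∈ γ∉))))
  ... | _ | _ | _ | _ | inj₂ (_ , γ∈ , γ∉) =
    inj₁ (unrotate (unrotate (unrotate (unrotate (colour-from-escape γ∈ γ∉)))))
  ... | inj₁ i₁₂ | inj₁ i₂₃ | inj₁ i₃₄ | inj₁ i₄₅ | inj₁ i₅₁ with c₁ ∈₃? L₁ P | c₃ ∈₃? L₃ P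
  ...   | no c₁∉ | _ = inj₁ (colour-from-spare i₁₂ i₂₃ i₃₄ i₄₅ c₁∉)
  ...   | _ | no c₃∉ = inj₁ (unrotate (unrotate (colour-from-spare i₃₄ i₄₅ i₅₁ i₁₂ c₃∉)))
  ...   | yes c₁∈ | yes c₃∈ = inj₂ (record
    { incl₁₂ = i₁₂ ; incl₂₃ = i₂₃ ; incl₃₄ = i₃₄ ; incl₄₅ = i₄₅ ; incl₅₁ = i₅₁
    ; c₁∈L₁ = c₁∈ ; c₃∈L₃ = c₃∈ })

  -- Otherwise c₁ lies in L₂ ∖ c₂ by the second blocking, and then in L₁ ∖ c₁ by the first.
  blocked-c₁-unique : ∀ {P c₁ c₂ c₃ c₄ c₅ d₁ d₂ d₃ d₄ d₅} →
                      Blocked P c₁ c₂ c₃ c₄ c₅ → Blocked P d₁ d₂ d₃ d₄ d₅ → c₁ ≢ c₂ → c₁ ≡ d₁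
  blocked-c₁-unique {c₁ = c₁} {d₁ = d₁} B B′ c₁≢c₂ = decidable-stable (c₁ ≟ d₁) λ c₁≢d₁ →
    let (c₁∈L₂ , _) = B′.incl₁₂ (B.c₁∈L₁ , c₁≢d₁)
    in proj₂ (B.incl₅₁ (B.incl₄₅ (B.incl₃₄ (B.incl₂₃ (c₁∈L₂ , c₁≢c₂))))) refl
    where
      module B = Blocked B
      module B′ = Blocked B′

  blocked-c₃-unique : ∀ {P c₁ c₂ c₃ c₄ c₅ d₁ d₂ d₃ d₄ d₅} →
                      Blocked P c₁ c₂ c₃ c₄ c₅ → Blocked P d₁ d₂ d₃ d₄ d₅ → c₁ ≡ d₁ → c₃ ≡ d₃
  blocked-c₃-unique {c₃ = c₃} {d₃ = d₃} B B′ refl = decidable-stable (c₃ ≟ d₃) λ c₃≢d₃ →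
    proj₂ (B.incl₂₃ (B.incl₁₂ (B′.incl₅₁ (B′.incl₄₅ (B′.incl₃₄ (B.c₃∈L₃ , c₃≢d₃)))))) refl
    where
      module B = Blocked B
      module B′ = Blocked B′

  -- A wing of W₂: x₁ x₂ x₃ x₄ close a 5-cycle through w, and the i-th vertex of the pentagon P
  -- is joined to the i-th vertex of w x₁ x₂ x₃ x₄.  The colours a, b, e below are those of u, v, w;
  -- u sees x₂ and v sees x₂ and x₄.
  record Wing : Set where
    constructor wing
    field
      X₁ X₂ X₃ X₄ : Triple
      P : Pentagon
  open Wing public

  record WingColouring (W : Wing) (a b e : C) : Set where
    constructor wing-colouring
    field
      k₁ k₂ k₃ k₄ : C
      k₁∈X₁ : k₁ ∈₃ X₁ W
      k₂∈X₂ : k₂ ∈₃ X₂ W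
      k₃∈X₃ : k₃ ∈₃ X₃ W
      k₄∈X₄ : k₄ ∈₃ X₄ W
      e≢k₁ : e ≢ k₁
      k₁≢k₂ : k₁ ≢ k₂
      k₂≢k₃ : k₂ ≢ k₃
      k₃≢k₄ : k₃ ≢ k₄
      k₄≢e : k₄ ≢ e
      a≢k₂ : a ≢ k₂
      b≢k₂ : b ≢ k₂
      b≢k₄ : b ≢ k₄
      rim : PentagonColouring (P W) e k₁ k₂ k₃ k₄

  record WingBlocked (W : Wing) (a b e : C) : Set where
    field
      t₁ t₂ t₃ t₄ : C
      e≢t₁ : e ≢ t₁
      blocked : Blocked (P W) e t₁ t₂ t₃ t₄
      x₂-forced : ∀ {z} → z ∈₃ X₂ W → z ≢ a → z ≢ b → z ≡ t₂

  module _ (W : Wing) {a b e s : C} (s∈X₄ : s ∈₃ X₄ W) (s≢b : s ≢ b) (s≢e : s ≢ e) where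

    colour-wing-or-block-at : ∀ {r} → r ∈₃ X₂ W → r ≢ a → r ≢ b →
      WingColouring W a b e ⊎ ∃₂ λ t₁ t₃ → e ≢ t₁ × Blocked (P W) e t₁ r t₃ s
    colour-wing-or-block-at {r} r∈X₂ r≢a r≢b =
      let (k₁ , k₁∈X₁ , k₁≢e , k₁≢r) = avoid₂ (X₁ W) e r
          (k₃ , k₃∈X₃ , k₃≢r , k₃≢s) = avoid₂ (X₃ W) r s
      in Sum.map
           (wing-colouring k₁ r k₃ s k₁∈X₁ r∈X₂ k₃∈X₃ s∈X₄ (≢-sym k₁≢e) k₁≢r (≢-sym k₃≢r) k₃≢s s≢e
              (≢-sym r≢a) (≢-sym r≢b) (≢-sym s≢b))
           (λ B → k₁ , k₃ , ≢-sym k₁≢e , B)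
           (colour-or-block (P W) e k₁ r k₃ s)

    -- If the attempt with r fails, r is the only colour left for x₂: a second one would give a
    -- second blocking with a different colour at the third pentagon vertex.
    colour-wing-or-block-from : ∀ {r} → r ∈₃ X₂ W → r ≢ a → r ≢ b →
                                WingColouring W a b e ⊎ WingBlocked W a b e
    colour-wing-or-block-from {r} r∈X₂ r≢a r≢b with colour-wing-or-block-at r∈X₂ r≢a r≢b
    ... | inj₁ κ = inj₁ κ
    ... | inj₂ (t₁ , t₃ , e≢t₁ , B)
      with any₃? (λ z → ¬? (z ≟ a) ×-dec ¬? (z ≟ b) ×-dec ¬? (z ≟ r)) (X₂ W)
    ...   | no ¬other = inj₂ (record
      { e≢t₁ = e≢t₁ ; blocked = B
      ; x₂-forced = λ {z} z∈X₂ z≢a z≢b →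
          decidable-stable (z ≟ r) (λ z≢r → ¬other (z , z∈X₂ , z≢a , z≢b , z≢r)) })
    ...   | yes (z , z∈X₂ , z≢a , z≢b , z≢r) with colour-wing-or-block-at z∈X₂ z≢a z≢b
    ...     | inj₁ κ = inj₁ κ
    ...     | inj₂ (_ , _ , _ , B′) = ⊥-elim (z≢r (sym (blocked-c₃-unique B B′ refl)))

  colour-wing-or-block : ∀ W a b e → WingColouring W a b e ⊎ WingBlocked W a b e
  colour-wing-or-block W a b e =
    let (r , r∈X₂ , r≢a , r≢b) = avoid₂ (X₂ W) a b
        (s , s∈X₄ , s≢b , s≢e) = avoid₂ (X₄ W) b e
    in colour-wing-or-block-from W s∈X₄ s≢b s≢e r∈X₂ r≢a r≢b

  wing-blocked-w-unique : ∀ {W a b e a′ b′ e′} → WingBlocked W a b e → WingBlocked W a′ b′ e′ → e ≡ e′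
  wing-blocked-w-unique β β′ =
    blocked-c₁-unique (WingBlocked.blocked β) (WingBlocked.blocked β′) (WingBlocked.e≢t₁ β)

  BlockingColour : Wing → Pred C 0ℓ
  BlockingColour W e = ∃₂ λ a b → WingBlocked W a b e

  blocking-colour-unique : ∀ W → Subsingleton (BlockingColour W)
  blocking-colour-unique W (_ , _ , β) (_ , _ , β′) = wing-blocked-w-unique β β′

  -- If b ≢ b′, every colour of x₂ other than a is the forced colour t₂ of one of the two
  -- blockings, and these agree; but X₂ has two colours other than a.
  wing-blocked-v-unique : ∀ {W a b b′ e e′} → WingBlocked W a b e → WingBlocked W a b′ e′ → b ≡ b′
  wing-blocked-v-unique {W} {a} {b} {b′} β β′ = decidable-stable (b ≟ b′) λ b≢b′ →
    ¬-⊆-subsingletons (X₂ W) (≡-subsingleton a) (≡-subsingleton β.t₂) (cover b≢b′)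
    where
      module β = WingBlocked β
      module β′ = WingBlocked β′
      t₂≡t₂′ : β.t₂ ≡ β′.t₂
      t₂≡t₂′ = blocked-c₃-unique β.blocked β′.blocked (wing-blocked-w-unique β β′)
      cover : b ≢ b′ → (_∈₃ X₂ W) ⊆ (_≡ a) ∪ (_≡ β.t₂)
      cover b≢b′ {z} z∈X₂ with z ≟ a | z ≟ b
      ... | yes z≡a | _ = inj₁ z≡a
      ... | no z≢a | no z≢b = inj₂ (β.x₂-forced z∈X₂ z≢a z≢b)
      ... | no z≢a | yes refl = inj₂ (trans (β′.x₂-forced z∈X₂ z≢a b≢b′) (sym t₂≡t₂′))

open ListColouring _≟_

module _ (A : Assignment3) where
  open Assignment3 A

  L : V → Triple
  L z = fromVec (S z) (S-size z)

  ∈L⇒∈S : ∀ z {c} → c ∈₃ L z → c ∈ S z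
  ∈L⇒∈S z = ∈-fromVec (S z) (S-size z)

  wingX wingY : Wing
  wingX = wing (L x₁) (L x₂) (L x₃) (L x₄) (pentagon (L p₁) (L p₂) (L p₃) (L p₄) (L p₅))
  wingY = wing (L y₁) (L y₂) (L y₃) (L y₄) (pentagon (L q₁) (L q₂) (L q₃) (L q₄) (L q₅))

  Extends : ℤ → ℤ → Set
  Extends a b = ∃ λ c → Proper c × FromLists S c × c u ≡ a × c v ≡ b

  glue : ∀ {a b e} → a ∈ S u → b ∈ S v → e ∈₃ L w → a ≢ e →
         WingColouring wingX a b e → WingColouring wingY a b e → Extends a b
  glue {a} {b} {e} a∈ b∈ e∈ a≢e κx κy = colour , proper , from-lists , refl , refl
    where
      module X = WingColouring κx
      module Y = WingColouring κy
      module PX = PentagonColouring X.rim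
      module PY = PentagonColouring Y.rim

      colour : V → ℤ
      colour u = a
      colour v = b
      colour w = e
      colour x₁ = X.k₁
      colour x₂ = X.k₂
      colour x₃ = X.k₃
      colour x₄ = X.k₄
      colour p₁ = PX.z₁
      colour p₂ = PX.z₂
      colour p₃ = PX.z₃
      colour p₄ = PX.z₄
      colour p₅ = PX.z₅
      colour y₁ = Y.k₁
      colour y₂ = Y.k₂
      colour y₃ = Y.k₃
      colour y₄ = Y.k₄
      colour q₁ = PY.z₁
      colour q₂ = PY.z₂
      colour q₃ = PY.z₃
      colour q₄ = PY.z₄
      colour q₅ = PY.z₅

      proper : Proper colour
      proper e-wx₁ = X.e≢k₁
      proper e-x₁x₂ = X.k₁≢k₂
      proper e-x₂x₃ = X.k₂≢k₃
      proper e-x₃x₄ = X.k₃≢k₄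
      proper e-x₄w = X.k₄≢e
      proper e-p₁p₂ = PX.z₁≢z₂
      proper e-p₂p₃ = PX.z₂≢z₃
      proper e-p₃p₄ = PX.z₃≢z₄
      proper e-p₄p₅ = PX.z₄≢z₅
      proper e-p₅p₁ = PX.z₅≢z₁
      proper e-wy₁ = Y.e≢k₁
      proper e-y₁y₂ = Y.k₁≢k₂
      proper e-y₂y₃ = Y.k₂≢k₃
      proper e-y₃y₄ = Y.k₃≢k₄
      proper e-y₄w = Y.k₄≢e
      proper e-q₁q₂ = PY.z₁≢z₂
      proper e-q₂q₃ = PY.z₂≢z₃
      proper e-q₃q₄ = PY.z₃≢z₄
      proper e-q₄q₅ = PY.z₄≢z₅
      proper e-q₅q₁ = PY.z₅≢z₁
      proper e-wp₁ = ≢-sym (proj₂ PX.z₁∈)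
      proper e-x₁p₂ = ≢-sym (proj₂ PX.z₂∈)
      proper e-x₂p₃ = ≢-sym (proj₂ PX.z₃∈)
      proper e-x₃p₄ = ≢-sym (proj₂ PX.z₄∈)
      proper e-x₄p₅ = ≢-sym (proj₂ PX.z₅∈)
      proper e-wq₁ = ≢-sym (proj₂ PY.z₁∈)
      proper e-y₁q₂ = ≢-sym (proj₂ PY.z₂∈)
      proper e-y₂q₃ = ≢-sym (proj₂ PY.z₃∈)
      proper e-y₃q₄ = ≢-sym (proj₂ PY.z₄∈)
      proper e-y₄q₅ = ≢-sym (proj₂ PY.z₅∈)
      proper e-uw = a≢e
      proper e-ux₂ = X.a≢k₂
      proper e-uy₂ = Y.a≢k₂
      proper e-vx₂ = X.b≢k₂
      proper e-vx₄ = X.b≢k₄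
      proper e-vy₂ = Y.b≢k₂
      proper e-vy₄ = Y.b≢k₄

      from-lists : FromLists S colour
      from-lists u = a∈
      from-lists v = b∈
      from-lists w = ∈L⇒∈S w e∈
      from-lists x₁ = ∈L⇒∈S x₁ X.k₁∈X₁
      from-lists x₂ = ∈L⇒∈S x₂ X.k₂∈X₂
      from-lists x₃ = ∈L⇒∈S x₃ X.k₃∈X₃
      from-lists x₄ = ∈L⇒∈S x₄ X.k₄∈X₄
      from-lists p₁ = ∈L⇒∈S p₁ (proj₁ PX.z₁∈)
      from-lists p₂ = ∈L⇒∈S p₂ (proj₁ PX.z₂∈)
      from-lists p₃ = ∈L⇒∈S p₃ (proj₁ PX.z₃∈)
      from-lists p₄ = ∈L⇒∈S p₄ (proj₁ PX.z₄∈)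
      from-lists p₅ = ∈L⇒∈S p₅ (proj₁ PX.z₅∈)
      from-lists y₁ = ∈L⇒∈S y₁ Y.k₁∈X₁
      from-lists y₂ = ∈L⇒∈S y₂ Y.k₂∈X₂
      from-lists y₃ = ∈L⇒∈S y₃ Y.k₃∈X₃
      from-lists y₄ = ∈L⇒∈S y₄ Y.k₄∈X₄
      from-lists q₁ = ∈L⇒∈S q₁ (proj₁ PY.z₁∈)
      from-lists q₂ = ∈L⇒∈S q₂ (proj₁ PY.z₂∈)
      from-lists q₃ = ∈L⇒∈S q₃ (proj₁ PY.z₃∈)
      from-lists q₄ = ∈L⇒∈S q₄ (proj₁ PY.z₄∈)
      from-lists q₅ = ∈L⇒∈S q₅ (proj₁ PY.z₅∈)

  blocked-somewhere : ∀ {a b e} → Incomp S (a , b) → e ∈₃ L w → e ≢ a →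
                      WingBlocked wingX a b e ⊎ WingBlocked wingY a b e
  blocked-somewhere {a} {b} {e} (a∈ , b∈ , ¬extends) e∈ e≢a
    with colour-wing-or-block wingX a b e | colour-wing-or-block wingY a b e
  ... | inj₂ βx | _ = inj₁ βx
  ... | _ | inj₂ βy = inj₂ βy
  ... | inj₁ κx | inj₁ κy = ⊥-elim (¬extends (glue a∈ b∈ e∈ (≢-sym e≢a) κx κy))

  -- If a ≢ a′, each colour of w differs from a or from a′, so some wing is blocked at it;
  -- but each wing is blocked at one colour of w at most.
  u-colour-unique : ∀ {a b a′ b′} → Incomp S (a , b) → Incomp S (a′ , b′) → a ≡ a′
  u-colour-unique {a} {b} {a′} {b′} inc inc′ = decidable-stable (a ≟ a′) λ a≢a′ →
    ¬-⊆-subsingletons (L w) (blocking-colour-unique wingX) (blocking-colour-unique wingY) (cover a≢a′)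
    where
      cover : a ≢ a′ → (_∈₃ L w) ⊆ BlockingColour wingX ∪ BlockingColour wingY
      cover a≢a′ {e} e∈ with e ≟ a
      ... | no e≢a = Sum.map (λ β → a , b , β) (λ β → a , b , β) (blocked-somewhere inc e∈ e≢a)
      ... | yes refl = Sum.map (λ β → a′ , b′ , β) (λ β → a′ , b′ , β) (blocked-somewhere inc′ e∈ a≢a′)

  x-wing-blocked : ∀ {a b} → Incomp S (a , b) → ∃ (WingBlocked wingX a b)
  x-wing-blocked {a} {b} inc =
    let (e , _ , β) = pigeonhole₃ (L w) (≡-subsingleton a) wing-blocked-w-unique cover in e , β
    where
      cover : (_∈₃ L w) ⊆ WingBlocked wingX a b ∪ (_≡ a) ∪ WingBlocked wingY a b
      cover {e} e∈ with e ≟ a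
      ... | yes e≡a = inj₂ (inj₁ e≡a)
      ... | no e≢a = Sum.map₂ inj₂ (blocked-somewhere inc e∈ e≢a)

lemma4p3 : (S : Assignment3) → AtMostOne (Incomp (Assignment3.S S))
lemma4p3 A {a , b} {a′ , b′} inc inc′ with u-colour-unique A inc inc′
... | refl = cong (a ,_) (wing-blocked-v-unique (proj₂ (x-wing-blocked A inc))
                                                 (proj₂ (x-wing-blocked A inc′)))
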